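{- Let $k\ge 3$ be an odd integer and let $H$ be an almost blue path on $t\ge 2k$ vertices. Let $\mathcal C$ be the family of all cycles of length at least $(t-k)/2$ and at most $t$. Then $\tilde{r}_H(C_k,\mathcal C)\le k+1$.
   Context: Online Ramsey game: Builder and Painter play on the infinite complete graph $K_{\mathbb N}$. For a colored graph $H$ (each edge red or blue) and nonempty families $\mathcal G_1,\mathcal G_2$ of finite graphs, the game $\tilde R_H(\mathcal G_1,\mathcal G_2)$ starts with a copy of $H$ already drawn and colored on the board. In each round Builder selects a previously unselected edge and Painter colors it red or blue. The game ends as soon as the graph of all colored edges contains a red copy of a graph in $\mathcal G_1$ or a blue copy of a graph in $\mathcal G_2$. $\tilde{r}_H(\mathcal G_1,\mathcal G_2)$ is the minimum number of rounds within which Builder can guarantee the end, both playing optimally; a single graph stands for the one-element family. $C_k$ is the cycle on $k$ vertices. An almost blue path is a path with at most one red edge and all other edges blue. -}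

module Defs where

open import Data.Nat using (ℕ; zero; suc; _+_; _*_; _∸_; _≤_)
open import Data.Fin using (Fin; toℕ)
open import Data.List using (List; []; _∷_)
open import Data.List.Membership.Propositional using (_∈_)
open import Data.Product using (Σ; ∃; ∃-syntax; _×_; _,_)
open import Data.Sum using (_⊎_)
open import Function.Definitions using (Injective)
open import Relation.Binary.PropositionalEquality using (_≡_; _≢_)
open import Relation.Nullary using (¬_)

data Color : Set where
  red blue : Color

-- A board: the list of coloured edges drawn so far, on vertex set ℕ
-- (the infinite complete graph K_ℕ). An entry (u , v , c) is the edge uv with colour c.
Board : Set
Board = List (ℕ × ℕ × Color)

Colored : Board → ℕ → ℕ → Color → Set
Colored B u v c = ((u , v , c) ∈ B) ⊎ ((v , u , c) ∈ B)

Selected : Board → ℕ → ℕ → Set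
Selected B u v = ∃[ c ] Colored B u v c

HasCycle : Board → Color → ℕ → Set
HasCycle B c m =
  3 ≤ m ×
  Σ (Fin m → ℕ) λ v →
    Injective _≡_ _≡_ v ×
    ((i j : Fin m) → (suc (toℕ i) ≡ toℕ j ⊎ (suc (toℕ i) ≡ m × toℕ j ≡ 0)) →
      Colored B (v i) (v j) c)

-- End condition of the game R̃_H(C_k, 𝒞) where 𝒞 = cycles of length ℓ
-- with (t - k)/2 ≤ ℓ ≤ t  (i.e. t - k ≤ 2ℓ; note t ≥ 2k > k so t ∸ k = t - k).
Target : ℕ → ℕ → Board → Set
Target k t B = HasCycle B red k ⊎ (∃[ ℓ ] (t ∸ k ≤ 2 * ℓ × ℓ ≤ t × HasCycle B blue ℓ))

-- Win T n B : starting from board B, Builder can force the end condition T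
-- within at most n rounds (against every Painter).
Win : (Board → Set) → ℕ → Board → Set
Win T zero B = T B
Win T (suc n) B =
  T B ⊎
  Σ ℕ λ u → Σ ℕ λ v → u ≢ v × ¬ Selected B u v × ((c : Color) → Win T n ((u , v , c) ∷ B))

pathBoard : List ℕ → List Color → Board
pathBoard (u ∷ v ∷ vs) (c ∷ cs) = (u , v , c) ∷ pathBoard (v ∷ vs) cs
pathBoard _ _ = []

countRed : List Color → ℕ
countRed [] = 0
countRed (red ∷ cs) = suc (countRed cs)
countRed (blue ∷ cs) = countRed cs

AlmostBlue : List Color → Set
AlmostBlue cs = countRed cs ≤ 1

Odd : ℕ → Set
Odd k = ∃[ m ] k ≡ suc (2 * m)

-- Index H as v₀ … v_{t-1} and write k = 2n + 3, t = 2k + 2h + e with e ≤ 1. If u + G ≤ v for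
-- G = n + h + 2 and H is blue between v_u and v_v, a blue chord v_u v_v closes a blue cycle of length
-- v - u + 1 ∈ [(t - k)/2, t]. Builder builds red copies of C_k out of red edges and such long chords,
-- each of which Painter must colour red or lose at once; the zigzag i, c, i+1, c+1, …, i+m, c+m with
-- i + m + G ≤ c consists of long chords.
--
-- If H is blue, a zigzag cycle on its first t - 1 vertices wins in k rounds. Otherwise let v_r v_{r+1}
-- be the red edge, with at least G edges after it (reverse H if not). Builder asks for v_x v_{t-1},
-- x ∈ {r - 1, r}. If Painter makes it blue, v₀ … v_x v_{t-1} v_{t-2} … v_{x+2} is a blue path on
-- t - 1 vertices and the first case applies. If red, it closes a red C_k together with the red edge,
-- a zigzag to the right of the red edge and, when that side is too short (x = r - 1), one to its left.

module Submission where

open import Defs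
open import Data.Nat using (ℕ; zero; suc; _+_; _*_; _∸_; _≤_; _<_; z≤n; s≤s; _≟_; _≤?_)
open import Data.Nat.Properties
open import Data.Fin using (Fin; toℕ) renaming (zero to fzero; suc to fsuc)
open import Data.Fin.Properties using (toℕ-injective; toℕ<n)
open import Data.List using (List; []; _∷_; length; _++_; lookup)
open import Data.List.Properties using (length-++)
open import Data.Nat.Tactic.RingSolver using (solve-∀)
open import Data.Nat.DivMod using (_/_; _%_; m≡m%n+[m/n]*n; m%n<n)
open import Data.List.Membership.Propositional using (_∈_)
open import Data.List.Membership.Propositional.Properties using (∈-lookup)
import Data.List.Membership.DecPropositional as DecMembership
open import Data.List.Relation.Binary.Subset.Propositional using (_⊆_)
open import Data.List.Relation.Binary.Subset.Propositional.Properties using (⊆-refl; ⊆-trans; xs⊆x∷xs)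
open import Data.List.Relation.Unary.All as All using (All; []; _∷_)
open import Data.List.Relation.Unary.All.Properties using () renaming (++⁺ to All-++⁺)
open import Data.List.Relation.Unary.Any using (here; there)
open import Data.List.Relation.Unary.AllPairs using ([]; _∷_)
open import Data.List.Relation.Unary.Unique.Propositional using (Unique)
open import Data.List.Relation.Unary.Unique.Propositional.Properties using () renaming (++⁺ to Unique-++⁺)
open import Data.Product using (Σ; ∃-syntax; _×_; _,_; proj₁; proj₂)
open import Data.Product.Properties using (≡-dec)
open import Data.Sum using (_⊎_; inj₁; inj₂)
import Data.Sum as Sum
open import Data.Empty using (⊥-elim)
open import Relation.Nullary using (Dec; yes; no)
open import Relation.Nullary.Decidable using (_⊎-dec_; map′)
open import Relation.Binary.Definitions using (DecidableEquality; tri<; tri≈; tri>)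
open import Relation.Binary.PropositionalEquality
  using (_≡_; _≢_; refl; sym; trans; cong; cong₂; subst; subst₂; module ≡-Reasoning)
open import Function using (_∘_)
open import Function.Definitions using (Injective)

Colored-mono : ∀ {B B' u v c} → B ⊆ B' → Colored B u v c → Colored B' u v c
Colored-mono B⊆B' = Sum.map B⊆B' B⊆B'

Colored-sym : ∀ {B u v c} → Colored B u v c → Colored B v u c
Colored-sym = Sum.swap

Colored-new : ∀ {B u v c} → Colored ((u , v , c) ∷ B) u v c
Colored-new = inj₁ (here refl)

_≟ᶜ_ : DecidableEquality Color
red  ≟ᶜ red  = yes refl
red  ≟ᶜ blue = no λ ()
blue ≟ᶜ red  = no λ ()
blue ≟ᶜ blue = yes refl

Colored? : ∀ B u v c → Dec (Colored B u v c)
Colored? B u v c = (u , v , c) ∈? B ⊎-dec (v , u , c) ∈? B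
  where open DecMembership (≡-dec _≟_ (≡-dec _≟_ _≟ᶜ_))

Selected? : ∀ B u v → Dec (Selected B u v)
Selected? B u v = map′ some-colour colour-cases (Colored? B u v red ⊎-dec Colored? B u v blue)
  where
  some-colour : Colored B u v red ⊎ Colored B u v blue → Selected B u v
  some-colour (inj₁ uv) = red , uv
  some-colour (inj₂ uv) = blue , uv
  colour-cases : Selected B u v → Colored B u v red ⊎ Colored B u v blue
  colour-cases (red , uv) = inj₁ uv
  colour-cases (blue , uv) = inj₂ uv

Walk : (ℕ → ℕ → Set) → ℕ → List ℕ → ℕ → Set
Walk R x []       y = R x y
Walk R x (z ∷ zs) y = R x z × Walk R z zs y

Walk-map : ∀ {R S : ℕ → ℕ → Set} → (∀ {a b} → R a b → S a b) →
           ∀ {x} xs {y} → Walk R x xs y → Walk S x xs y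
Walk-map R⇒S []       xy        = R⇒S xy
Walk-map R⇒S (z ∷ zs) (xz , zy) = R⇒S xz , Walk-map R⇒S zs zy

Walk-++ : ∀ {R x} xs {y} ys {z} → Walk R x xs y → Walk R y ys z → Walk R x (xs ++ y ∷ ys) z
Walk-++ []       ys xy        yz = xy , yz
Walk-++ (w ∷ ws) ys (xw , wy) yz = xw , Walk-++ ws ys wy yz

Walk-step : ∀ {R x} xs {y} (i j : Fin (suc (length xs))) → suc (toℕ i) ≡ toℕ j →
            Walk R x xs y → R (lookup (x ∷ xs) i) (lookup (x ∷ xs) j)
Walk-step (z ∷ zs) fzero    (fsuc fzero) refl (xz , _) = xz
Walk-step (z ∷ zs) (fsuc i) (fsuc j)     i→j  (_ , zy) = Walk-step zs i j (suc-injective i→j) zy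

Walk-last : ∀ {R x} xs {y} (i : Fin (suc (length xs))) → toℕ i ≡ length xs →
            Walk R x xs y → R (lookup (x ∷ xs) i) y
Walk-last []       fzero    refl xy       = xy
Walk-last (z ∷ zs) (fsuc i) i-last (_ , zy) = Walk-last zs i (suc-injective i-last) zy

module Game (T : Board → Set) where

  Win-done : ∀ n {B} → T B → Win T n B
  Win-done zero    end = end
  Win-done (suc n) end = inj₁ end

  Win-suc : ∀ n {B} → Win T n B → Win T (suc n) B
  Win-suc zero    end                                 = inj₁ end
  Win-suc (suc n) (inj₁ end)                          = inj₁ end
  Win-suc (suc n) (inj₂ (u , v , u≢v , fresh , next)) = inj₂ (u , v , u≢v , fresh , λ c → Win-suc n (next c))

  ForcedBlue : Board → ℕ → ℕ → Set
  ForcedBlue B u v = ∀ {B'} → B ⊆ B' → Colored B' u v blue → T B'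

  RedOrForced : Board → ℕ → ℕ → Set
  RedOrForced B u v = Colored B u v red ⊎ (u ≢ v × ForcedBlue B u v)

  RedOrForced-mono : ∀ {B B' u v} → B ⊆ B' → RedOrForced B u v → RedOrForced B' u v
  RedOrForced-mono B⊆B' (inj₁ uv) = inj₁ (Colored-mono B⊆B' uv)
  RedOrForced-mono B⊆B' (inj₂ (u≢v , forced)) = inj₂ (u≢v , λ B'⊆B'' → forced (⊆-trans B⊆B' B'⊆B''))

  RedOrForced-sym : ∀ {B u v} → RedOrForced B u v → RedOrForced B v u
  RedOrForced-sym (inj₁ uv) = inj₁ (Colored-sym uv)
  RedOrForced-sym (inj₂ (u≢v , forced)) = inj₂ (u≢v ∘ sym , λ B⊆B' vu → forced B⊆B' (Colored-sym vu))

  Win-by-edge : ∀ n {B u v} → u ≢ v → (∀ c {B'} → B ⊆ B' → Colored B' u v c → Win T n B') → Win T (suc n) B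
  Win-by-edge n {B} {u} {v} u≢v next with Selected? B u v
  ... | yes (c , uv) = Win-suc n (next c ⊆-refl uv)
  ... | no fresh      = inj₂ (u , v , u≢v , fresh , λ c → next c (xs⊆x∷xs B _) Colored-new)

  Win-by-red-edge : ∀ n {B u v} → RedOrForced B u v →
                    (∀ {B'} → B ⊆ B' → Colored B' u v red → Win T n B') → Win T (suc n) B
  Win-by-red-edge n (inj₁ uv) next = Win-suc n (next ⊆-refl uv)
  Win-by-red-edge n (inj₂ (u≢v , forced)) next = Win-by-edge n u≢v λ
    { red  B⊆B' uv → next B⊆B' uv
    ; blue B⊆B' uv → Win-done n (forced B⊆B' uv) }


  Win-by-red-walk : ∀ {f : ℕ → ℕ} {B x} xs {y} → Walk (λ a b → RedOrForced B (f a) (f b)) x xs y →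
                    (∀ {B'} → B ⊆ B' → Walk (λ a b → Colored B' (f a) (f b) red) x xs y → T B') →
                    Win T (suc (length xs)) B
  Win-by-red-walk     []       xy        done = Win-by-red-edge 0 xy done
  Win-by-red-walk {f} (z ∷ zs) (xz , zy) done = Win-by-red-edge (suc (length zs)) xz λ B⊆B' xz-red →
    Win-by-red-walk {f} zs (Walk-map (RedOrForced-mono B⊆B') zs zy) λ B'⊆B'' zy-red →
      done (⊆-trans B⊆B' B'⊆B'') (Colored-mono B'⊆B'' xz-red , zy-red)

InjectiveUpTo : (ℕ → ℕ) → ℕ → Set
InjectiveUpTo f L = ∀ {i j} → i ≤ L → j ≤ L → f i ≡ f j → i ≡ j

InjectiveUpTo-sub : ∀ {g L L'} → L' ≤ L → InjectiveUpTo g L → InjectiveUpTo g L'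
InjectiveUpTo-sub L'≤L g-inj i≤ j≤ = g-inj (≤-trans i≤ L'≤L) (≤-trans j≤ L'≤L)

InjectiveUpTo-mirror : ∀ {f} N → InjectiveUpTo f N → InjectiveUpTo (λ i → f (N ∸ i)) N
InjectiveUpTo-mirror N f-inj {i} {j} i≤N j≤N eq = ∸-cancelˡ-≡ i≤N j≤N (f-inj (m∸n≤m N i) (m∸n≤m N j) eq)

Unique-lookup-injective : ∀ {A : Set} {xs : List A} → Unique xs → Injective _≡_ _≡_ (lookup xs)
Unique-lookup-injective {xs = x ∷ xs} (x∉ ∷ _) {fzero}  {fzero}  _  = refl
Unique-lookup-injective {xs = x ∷ xs} (x∉ ∷ _) {fzero}  {fsuc j} eq = ⊥-elim (All.lookup x∉ (∈-lookup j) eq)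
Unique-lookup-injective {xs = x ∷ xs} (x∉ ∷ _) {fsuc i} {fzero}  eq = ⊥-elim (All.lookup x∉ (∈-lookup i) (sym eq))
Unique-lookup-injective {xs = x ∷ xs} (_ ∷ u)  {fsuc i} {fsuc j} eq = cong fsuc (Unique-lookup-injective u eq)

closed-walk⇒HasCycle : ∀ {B c f L w} xs → InjectiveUpTo f L → All (_≤ L) (w ∷ xs) → Unique (w ∷ xs) →
                       2 ≤ length xs → Walk (λ a b → Colored B (f a) (f b) c) w xs w →
                       HasCycle B c (suc (length xs))
closed-walk⇒HasCycle {B} {c} {f} {L} {w} xs f-inj bounded unique 2≤ walk =
  s≤s 2≤ , vertex , vertex-injective , edge
  where
  vertex : Fin (suc (length xs)) → ℕ
  vertex i = f (lookup (w ∷ xs) i)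
  bound : ∀ i → lookup (w ∷ xs) i ≤ L
  bound i = All.lookup bounded (∈-lookup i)
  vertex-injective : Injective _≡_ _≡_ vertex
  vertex-injective {i} {j} eq = Unique-lookup-injective unique (f-inj (bound i) (bound j) eq)
  edge : ∀ i j → (suc (toℕ i) ≡ toℕ j ⊎ (suc (toℕ i) ≡ suc (length xs) × toℕ j ≡ 0)) →
         Colored B (vertex i) (vertex j) c
  edge i j        (inj₁ i→j)         = Walk-step xs i j i→j walk
  edge i fzero    (inj₂ (i-last , _)) = Walk-last xs i (suc-injective i-last) walk
  edge i (fsuc j) (inj₂ (_ , ()))

m+n≡o⇒m≤o : ∀ {m} n {o} → m + n ≡ o → m ≤ o
m+n≡o⇒m≤o {m} n m+n≡o = m+n≤o⇒m≤o m (≤-reflexive m+n≡o)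

∸-suc : ∀ {N i} → i < N → N ∸ i ≡ suc (N ∸ suc i)
∸-suc {N} {i} i<N = +-∸-assoc 1 i<N

half-bounds : ∀ c → c / 2 + c / 2 ≤ c × c ≤ suc (c / 2 + c / 2)
half-bounds c = subst (c / 2 + c / 2 ≤_) (sym c≡) (m≤n+m _ (c % 2)) ,
                subst (_≤ suc (c / 2 + c / 2)) (sym c≡) (+-monoˡ-≤ _ (≤-pred (m%n<n c 2)))
  where
  c≡ : c ≡ c % 2 + (c / 2 + c / 2)
  c≡ = trans (m≡m%n+[m/n]*n c 2) (cong (c % 2 +_) (trans (*-comm (c / 2) 2) (cong (c / 2 +_) (+-identityʳ (c / 2)))))

_∈[_,_⟩ : ℕ → ℕ → ℕ → Set
v ∈[ lo , hi ⟩ = lo ≤ v × v < hi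

range-start : ∀ a n → a ∈[ a , a + suc n ⟩
range-start a n = ≤-refl , subst (a <_) (sym (+-suc a n)) (s≤s (m≤m+n a n))

range-tail : ∀ {a n v} → v ∈[ suc a , suc a + n ⟩ → v ∈[ a , a + suc n ⟩
range-tail {a} {n} {v} (a<v , v<) = <⇒≤ a<v , subst (v <_) (sym (+-suc a n)) v<

zigzag : ℕ → ℕ → ℕ → List ℕ
zigzag a b zero    = []
zigzag a b (suc n) = a ∷ b ∷ zigzag (suc a) (suc b) n

length-zigzag : ∀ a b n → length (zigzag a b n) ≡ n + n
length-zigzag a b zero    = refl
length-zigzag a b (suc n) = trans (cong (suc ∘ suc) (length-zigzag (suc a) (suc b) n)) (cong suc (sym (+-suc n n)))

zigzag-walk : ∀ {C : ℕ → ℕ → Set} → (∀ {u v} → C u v → C v u) → ∀ n a b x y →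
              (∀ {u v} → u ≡ x ⊎ u ∈[ b , b + n ⟩ → v ≡ y ⊎ v ∈[ a , a + n ⟩ → C u v) →
              Walk C x (zigzag a b n) y
zigzag-walk C-sym zero    a b x y far = far (inj₁ refl) (inj₁ refl)
zigzag-walk C-sym (suc n) a b x y far =
  far (inj₁ refl) (inj₂ (range-start a n)) ,
  C-sym (far (inj₂ (range-start b n)) (inj₂ (range-start a n))) ,
  zigzag-walk C-sym n (suc a) (suc b) b y λ u-side v-side → far (from-b u-side) (Sum.map₂ range-tail v-side)
  where
  from-b : ∀ {u} → u ≡ b ⊎ u ∈[ suc b , suc b + n ⟩ → u ≡ x ⊎ u ∈[ b , b + suc n ⟩
  from-b (inj₁ refl) = inj₂ (range-start b n)
  from-b (inj₂ u∈)   = inj₂ (range-tail u∈)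

zigzag-∈ : ∀ a b n {v} → v ∈ zigzag a b n → v ∈[ a , a + n ⟩ ⊎ v ∈[ b , b + n ⟩
zigzag-∈ a b (suc n) (here refl)         = inj₁ (range-start a n)
zigzag-∈ a b (suc n) (there (here refl)) = inj₂ (range-start b n)
zigzag-∈ a b (suc n) (there (there v∈))  = Sum.map range-tail range-tail (zigzag-∈ (suc a) (suc b) n v∈)

zigzag-all : ∀ {P : ℕ → Set} a b n → (∀ {v} → v ∈[ a , a + n ⟩ ⊎ v ∈[ b , b + n ⟩ → P v) →
             All P (zigzag a b n)
zigzag-all a b n P-ranges = All.tabulate (λ v∈ → P-ranges (zigzag-∈ a b n v∈))

ranges-apart : ∀ {a b n u v} → a + n ≤ b ⊎ b + n ≤ a → u ∈[ a , a + n ⟩ → v ∈[ b , b + n ⟩ → u ≢ v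
ranges-apart (inj₁ a+n≤b) (_ , u<) (b≤v , _) refl = <-irrefl refl (≤-trans u< (≤-trans a+n≤b b≤v))
ranges-apart (inj₂ b+n≤a) (a≤u , _) (_ , v<) refl = <-irrefl refl (≤-trans v< (≤-trans b+n≤a a≤u))

zigzag-unique : ∀ a b n → a + n ≤ b ⊎ b + n ≤ a → Unique (zigzag a b n)
zigzag-unique a b zero    _     = []
zigzag-unique a b (suc n) apart =
  (ranges-apart apart (range-start a n) (range-start b n) ∷ zigzag-all (suc a) (suc b) n a≢) ∷
  zigzag-all (suc a) (suc b) n b≢ ∷
  zigzag-unique (suc a) (suc b) n (Sum.map shift shift apart)
  where
  shift : ∀ {c d} → c + suc n ≤ d → suc c + n ≤ suc d
  shift {c} c+n≤d = ≤-trans (≤-reflexive (sym (+-suc c n))) (m≤n⇒m≤1+n c+n≤d)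
  a≢ : ∀ {v} → v ∈[ suc a , suc a + n ⟩ ⊎ v ∈[ suc b , suc b + n ⟩ → a ≢ v
  a≢ (inj₁ (a<v , _)) = <⇒≢ a<v
  a≢ (inj₂ v∈)        = ranges-apart apart (range-start a n) (range-tail v∈)
  b≢ : ∀ {v} → v ∈[ suc a , suc a + n ⟩ ⊎ v ∈[ suc b , suc b + n ⟩ → b ≢ v
  b≢ (inj₁ v∈)        = ranges-apart apart (range-tail v∈) (range-start b n) ∘ sym
  b≢ (inj₂ (b<v , _)) = <⇒≢ b<v

zigzag-rotate : ∀ a b n → b ∷ zigzag a (suc b) n ++ a + n ∷ [] ≡ zigzag b a (suc n)
zigzag-rotate a b zero    = cong (λ v → b ∷ v ∷ []) (+-identityʳ a)
zigzag-rotate a b (suc n) = cong (λ zs → b ∷ a ∷ zs)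
  (trans (cong (λ v → suc b ∷ zigzag (suc a) (suc (suc b)) n ++ v ∷ []) (+-suc a n))
         (zigzag-rotate (suc a) (suc b) n))

BlueRun : Board → (ℕ → ℕ) → ℕ → ℕ → Set
BlueRun B g lo hi = ∀ {i} → lo ≤ i → i < hi → Colored B (g i) (g (suc i)) blue

BlueRun-mono : ∀ {B B' g lo hi} → B ⊆ B' → BlueRun B g lo hi → BlueRun B' g lo hi
BlueRun-mono B⊆B' run lo≤i i<hi = Colored-mono B⊆B' (run lo≤i i<hi)

BlueRun-sub : ∀ {B g lo lo' hi hi'} → lo ≤ lo' → hi' ≤ hi → BlueRun B g lo hi → BlueRun B g lo' hi'
BlueRun-sub lo≤lo' hi'≤hi run lo'≤i i<hi' = run (≤-trans lo≤lo' lo'≤i) (≤-trans i<hi' hi'≤hi)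

BlueRun-mirror : ∀ {B g lo hi} N → BlueRun B g lo hi → BlueRun B (λ i → g (N ∸ i)) (N ∸ hi) (N ∸ lo)
BlueRun-mirror {B} {g} {lo} {hi} N run {i} N-hi≤i i<N-lo =
  subst (λ m → Colored B (g m) (g (N ∸ suc i)) blue) (sym (∸-suc i<N)) (Colored-sym (run lo≤m m<hi))
  where
  i<N : i < N
  i<N = ≤-trans i<N-lo (m∸n≤m N lo)
  lo≤N : lo ≤ N
  lo≤N = <⇒≤ (m∸n≢0⇒n<m (<⇒≢ (≤-trans (s≤s z≤n) i<N-lo) ∘ sym))
  lo≤m : lo ≤ N ∸ suc i
  lo≤m = m+n≤o⇒m≤o∸n lo (subst (_≤ N) (+-comm (suc i) lo) (m≤o∸n⇒m+n≤o (suc i) lo≤N i<N-lo))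
  m<hi : N ∸ suc i < hi
  m<hi = subst (_≤ hi) (∸-suc i<N)
           (m≤n+o⇒m∸n≤o N i (subst (N ≤_) (+-comm hi i) (≤-trans (m≤n+m∸n N hi) (+-monoʳ-≤ hi N-hi≤i))))

blue-chord⇒HasCycle : ∀ {B g lo hi u} d → BlueRun B g lo hi → InjectiveUpTo g hi → lo ≤ u → u + d ≤ hi →
                      2 ≤ d → Colored B (g u) (g (u + d)) blue → HasCycle B blue (suc d)
blue-chord⇒HasCycle {B} {g} {lo} {hi} {u} d run g-inj lo≤u u+d≤hi 2≤d chord =
  s≤s 2≤d , vertex , vertex-injective , edge
  where
  vertex : Fin (suc d) → ℕ
  vertex i = g (u + toℕ i)
  on-run : ∀ (i : Fin (suc d)) → u + toℕ i ≤ hi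
  on-run i = ≤-trans (+-monoʳ-≤ u (≤-pred (toℕ<n i))) u+d≤hi
  vertex-injective : Injective _≡_ _≡_ vertex
  vertex-injective {i} {j} eq = toℕ-injective (+-cancelˡ-≡ u _ _ (g-inj (on-run i) (on-run j) eq))
  edge : ∀ i j → (suc (toℕ i) ≡ toℕ j ⊎ (suc (toℕ i) ≡ suc d × toℕ j ≡ 0)) →
         Colored B (vertex i) (vertex j) blue
  edge i j (inj₁ i→j) =
    subst (λ m → Colored B (vertex i) (g m) blue) next
      (run (≤-trans lo≤u (m≤m+n u _)) (subst (_≤ hi) (sym next) (on-run j)))
    where
    next : suc (u + toℕ i) ≡ u + toℕ j
    next = trans (sym (+-suc u (toℕ i))) (cong (u +_) i→j)
  edge i j (inj₂ (i-last , j-first)) =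
    subst₂ (λ a b → Colored B (g (u + a)) (g (u + b)) blue) (sym (suc-injective i-last)) (sym j-first)
      (Colored-sym (subst (λ m → Colored B (g m) (g (u + d)) blue) (sym (+-identityʳ u)) chord))

glue : ℕ → (ℕ → ℕ) → (ℕ → ℕ) → ℕ → ℕ
glue x g₁ g₂ i with i ≤? x
... | yes _ = g₁ i
... | no  _ = g₂ (i ∸ suc x)

low-or-high : ∀ x i → i ≤ x ⊎ ∃[ j ] i ≡ j + suc x
low-or-high x i with i ≤? x
... | yes i≤x = inj₁ i≤x
... | no  i≰x = inj₂ (i ∸ suc x , sym (m∸n+n≡m (≰⇒> i≰x)))

module _ {x : ℕ} {g₁ g₂ : ℕ → ℕ} where

  glue-low : ∀ {i} → i ≤ x → glue x g₁ g₂ i ≡ g₁ i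
  glue-low {i} i≤x with i ≤? x
  ... | yes _   = refl
  ... | no  i≰x = ⊥-elim (i≰x i≤x)

  glue-high : ∀ j → glue x g₁ g₂ (j + suc x) ≡ g₂ j
  glue-high j with j + suc x ≤? x
  ... | yes j+x<x = ⊥-elim (<-irrefl refl (≤-trans (s≤s (m≤n+m x j)) (subst (_≤ x) (+-suc j x) j+x<x)))
  ... | no  _     = cong g₂ (m+n∸n≡m j (suc x))

  BlueRun-glue : ∀ {B m} → BlueRun B g₁ 0 x → Colored B (g₁ x) (g₂ 0) blue → BlueRun B g₂ 0 m →
                 BlueRun B (glue x g₁ g₂) 0 (m + suc x)
  BlueRun-glue {B} {m} run₁ bridge run₂ {i} _ i<end with <-cmp i x
  ... | tri< i<x _ _ =
    subst₂ (λ a b → Colored B a b blue) (sym (glue-low (<⇒≤ i<x))) (sym (glue-low i<x)) (run₁ z≤n i<x)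
  ... | tri≈ _ refl _ =
    subst₂ (λ a b → Colored B a b blue) (sym (glue-low ≤-refl)) (sym (glue-high 0)) bridge
  ... | tri> _ _ x<i =
    subst (λ i → Colored B (glue x g₁ g₂ i) (glue x g₁ g₂ (suc i)) blue) (sym i≡j+x)
      (subst₂ (λ a b → Colored B a b blue) (sym (glue-high j)) (sym (glue-high (suc j)))
        (run₂ z≤n (+-cancelʳ-< (suc x) j m (subst (_< m + suc x) i≡j+x i<end))))
    where
    j : ℕ
    j = i ∸ suc x
    i≡j+x : i ≡ j + suc x
    i≡j+x = sym (m∸n+n≡m x<i)

  InjectiveUpTo-glue : ∀ {m} → InjectiveUpTo g₁ x → InjectiveUpTo g₂ m →
                       (∀ {i j} → i ≤ x → j ≤ m → g₁ i ≢ g₂ j) → InjectiveUpTo (glue x g₁ g₂) (m + suc x)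
  InjectiveUpTo-glue {m} g₁-inj g₂-inj apart {i} {j} i≤ j≤ eq
    with low-or-high x i | low-or-high x j
  ... | inj₁ i≤x | inj₁ j≤x = g₁-inj i≤x j≤x (trans (sym (glue-low i≤x)) (trans eq (glue-low j≤x)))
  ... | inj₁ i≤x | inj₂ (j' , refl) =
    ⊥-elim (apart i≤x (+-cancelʳ-≤ (suc x) j' m j≤) (trans (sym (glue-low i≤x)) (trans eq (glue-high j'))))
  ... | inj₂ (i' , refl) | inj₁ j≤x =
    ⊥-elim (apart j≤x (+-cancelʳ-≤ (suc x) i' m i≤) (trans (sym (glue-low j≤x)) (trans (sym eq) (glue-high i'))))
  ... | inj₂ (i' , refl) | inj₂ (j' , refl) =
    cong (_+ suc x) (g₂-inj (+-cancelʳ-≤ (suc x) i' m i≤) (+-cancelʳ-≤ (suc x) j' m j≤)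
      (trans (sym (glue-high i')) (trans eq (glue-high j'))))

-- The new path is f 0, …, f x, f (L+1), f L, …, f (x+2); it avoids the red edge.
reroute : ∀ {B f L r x} → InjectiveUpTo f (suc L) → BlueRun B f 0 r → BlueRun B f (suc r) (suc L) →
          x ≤ r → r ≤ suc x → r < L → Colored B (f x) (f (suc L)) blue →
          Σ (ℕ → ℕ) λ g → BlueRun B g 0 L × InjectiveUpTo g L
reroute {B} {f} {L} {r} {x} f-inj left right x≤r r≤1+x r<L bridge =
  glue x f far ,
  subst (BlueRun B (glue x f far) 0) m+x≡L
    (BlueRun-glue (BlueRun-sub ≤-refl x≤r left) bridge far-run) ,
  subst (InjectiveUpTo (glue x f far)) m+x≡L
    (InjectiveUpTo-glue (InjectiveUpTo-sub (≤-trans x≤r (≤-trans (<⇒≤ r<L) (n≤1+n L))) f-inj)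
                        (InjectiveUpTo-sub (≤-trans (m∸n≤m L (suc x)) (n≤1+n L)) (InjectiveUpTo-mirror (suc L) f-inj))
                        apart)
  where
  far : ℕ → ℕ
  far j = f (suc L ∸ j)
  m : ℕ
  m = L ∸ suc x
  x<L : x < L
  x<L = ≤-trans (s≤s x≤r) r<L
  m+x≡L : m + suc x ≡ L
  m+x≡L = m∸n+n≡m x<L
  far-run : BlueRun B far 0 m
  far-run = BlueRun-sub (≤-reflexive (n∸n≡0 (suc L))) ≤-refl
              (BlueRun-mirror (suc L) (BlueRun-sub (s≤s r≤1+x) ≤-refl right))
  apart : ∀ {i j} → i ≤ x → j ≤ m → f i ≢ far j
  apart {i} {j} i≤x j≤m eq = <-irrefl same (≤-trans (s≤s (m≤n⇒m≤1+n i≤x)) far-index)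
    where
    far-index : suc (suc x) ≤ suc L ∸ j
    far-index = m+n≤o⇒m≤o∸n (suc (suc x))
                  (s≤s (subst (_≤ L) (+-comm j (suc x)) (m≤o∸n⇒m+n≤o j x<L j≤m)))
    same : i ≡ suc L ∸ j
    same = f-inj (m≤n⇒m≤1+n (≤-trans i≤x (<⇒≤ x<L))) (m∸n≤m (suc L) j) eq

RedEdgeAt : Board → (ℕ → ℕ) → ℕ → ℕ → Set
RedEdgeAt B f L r = r < L × BlueRun B f 0 r × Colored B (f r) (f (suc r)) red × BlueRun B f (suc r) L

AlmostBluePath : Board → (ℕ → ℕ) → ℕ → Set
AlmostBluePath B f L = InjectiveUpTo f L × (BlueRun B f 0 L ⊎ ∃[ r ] RedEdgeAt B f L r)

red-edge-mirror : ∀ {B f L r} → r < L → BlueRun B f 0 r → Colored B (f r) (f (suc r)) red →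
                  BlueRun B f (suc r) L →
                  let f' = λ i → f (L ∸ i) ; r' = L ∸ suc r in
                  BlueRun B f' 0 r' × Colored B (f' r') (f' (suc r')) red × BlueRun B f' (suc r') L
red-edge-mirror {B} {f} {L} {r} r<L left red-edge right =
  BlueRun-sub (≤-reflexive (n∸n≡0 L)) ≤-refl (BlueRun-mirror L right) ,
  subst₂ (λ a b → Colored B (f a) (f b) red) (sym L∸r'≡1+r) (sym L∸1+r'≡r) (Colored-sym red-edge) ,
  BlueRun-sub (≤-reflexive (∸-suc r<L)) ≤-refl (BlueRun-mirror L left)
  where
  r' : ℕ
  r' = L ∸ suc r
  L∸r'≡1+r : L ∸ r' ≡ suc r
  L∸r'≡1+r = m∸[m∸n]≡n r<L
  L∸1+r'≡r : L ∸ suc r' ≡ r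
  L∸1+r'≡r = suc-injective (trans (sym (∸-suc (∸-monoʳ-< (s≤s z≤n) r<L))) L∸r'≡1+r)

Chord : ℕ → ℕ → ℕ → ℕ → ℕ → Set
Chord G lo hi u v = lo ≤ u × u + G ≤ v × v ≤ hi

LongChord : ℕ → ℕ → ℕ → ℕ → ℕ → Set
LongChord G lo hi u v = Chord G lo hi u v ⊎ Chord G lo hi v u

LongChord-sym : ∀ {G lo hi u v} → LongChord G lo hi u v → LongChord G lo hi v u
LongChord-sym = Sum.swap

lower-end : ∀ {lo m v} → v ≡ lo ⊎ v ∈[ suc lo , suc lo + m ⟩ → lo ≤ v × v ≤ lo + m
lower-end {lo} {m} (inj₁ refl)       = ≤-refl , m≤m+n lo m
lower-end         (inj₂ (lo<v , v<)) = <⇒≤ lo<v , ≤-pred v<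

upper-end : ∀ {c m v} → v ≡ c + m ⊎ v ∈[ c , c + m ⟩ → c ≤ v × v ≤ c + m
upper-end {c} {m} (inj₁ refl)      = m≤m+n c m , ≤-refl
upper-end         (inj₂ (c≤v , v<)) = c≤v , <⇒≤ v<

zigzag-chords-upward : ∀ G m c hi → m + G ≤ c → c + m ≤ hi →
                       Walk (LongChord G 0 hi) 0 (zigzag c 1 m) (c + m)
zigzag-chords-upward G m c hi m+G≤c c+m≤hi = zigzag-walk LongChord-sym m c 1 0 (c + m) λ u-low v-high →
  let (_ , u≤m) = lower-end u-low ; (c≤v , v≤c+m) = upper-end v-high
  in inj₁ (z≤n , ≤-trans (+-monoˡ-≤ G u≤m) (≤-trans m+G≤c c≤v) , ≤-trans v≤c+m c+m≤hi)

zigzag-chords-downward : ∀ G lo m c → lo + m + G ≤ c →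
                         Walk (LongChord G lo (c + m)) (c + m) (zigzag (suc lo) c m) lo
zigzag-chords-downward G lo m c lo+m+G≤c = zigzag-walk LongChord-sym m (suc lo) c (c + m) lo λ u-high v-low →
  let (c≤u , u≤c+m) = upper-end u-high ; (lo≤v , v≤lo+m) = lower-end v-low
  in inj₂ (lo≤v , ≤-trans (+-monoˡ-≤ G v≤lo+m) (≤-trans lo+m+G≤c c≤u) , u≤c+m)

zigzag-below : ∀ G m x → 1 ≤ G → m + G + m ≤ x →
               Σ (List ℕ) λ zs → length zs ≡ suc (m + m) × All (_≤ x) (zs ++ x ∷ []) × Unique (zs ++ x ∷ []) ×
                                 Walk (LongChord G 0 (suc x)) (suc x) zs x
zigzag-below G m x 1≤G m+G+m≤x =
  0 ∷ zigzag c 1 m ,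
  cong suc (length-zigzag c 1 m) ,
  subst (All (_≤ x)) (sym vertices≡) (zigzag-all 0 c (suc m) λ {v} → λ
    { (inj₁ (_ , v<)) → ≤-trans (≤-pred v<) m≤x
    ; (inj₂ (_ , v<)) → ≤-pred (subst (v <_) (trans (+-suc c m) (cong suc c+m≡x)) v<) }) ,
  subst Unique (sym vertices≡) (zigzag-unique 0 c (suc m) (inj₁ 1+m≤c)) ,
  (inj₂ (z≤n , ≤-trans (m≤n+m G m) (≤-trans (m≤m+n (m + G) m) (m≤n⇒m≤1+n m+G+m≤x)) , ≤-refl) ,
   subst (Walk (LongChord G 0 (suc x)) 0 (zigzag c 1 m)) c+m≡x
     (zigzag-chords-upward G m c (suc x) m+G≤c (m≤n⇒m≤1+n (≤-reflexive c+m≡x))))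
  where
  m≤x : m ≤ x
  m≤x = ≤-trans (m≤n+m m (m + G)) m+G+m≤x
  c : ℕ
  c = x ∸ m
  c+m≡x : c + m ≡ x
  c+m≡x = m∸n+n≡m m≤x
  vertices≡ : 0 ∷ zigzag c 1 m ++ x ∷ [] ≡ zigzag 0 c (suc m)
  vertices≡ = subst (λ y → 0 ∷ zigzag c 1 m ++ y ∷ [] ≡ zigzag 0 c (suc m)) c+m≡x (zigzag-rotate c 0 m)
  m+G≤c : m + G ≤ c
  m+G≤c = m+n≤o⇒m≤o∸n (m + G) m+G+m≤x
  1+m≤c : suc m ≤ c
  1+m≤c = ≤-trans (m<m+n m 1≤G) m+G≤c

zigzag-above : ∀ G lo s top → 1 ≤ G → lo + G + (s + s) ≤ top →
               Σ (List ℕ) λ zs → length zs ≡ s + s × All (λ v → suc lo ≤ v × v < top) zs × Unique zs ×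
                                 Walk (LongChord G lo top) top zs lo
zigzag-above G lo s top 1≤G room =
  zigzag (suc lo) c s ,
  length-zigzag (suc lo) c s ,
  zigzag-all (suc lo) c s (λ {v} → λ
    { (inj₁ (lo<v , v<)) → lo<v , ≤-trans v< (≤-trans lo+s<c c≤top)
    ; (inj₂ (c≤v , v<)) → ≤-trans (s≤s (m≤m+n lo s)) (≤-trans lo+s<c c≤v) , subst (v <_) c+s≡top v< }) ,
  zigzag-unique (suc lo) c s (inj₁ lo+s<c) ,
  subst (λ y → Walk (LongChord G lo y) y (zigzag (suc lo) c s) lo) c+s≡top (zigzag-chords-downward G lo s c gap)
  where
  c : ℕ
  c = top ∸ s
  s≤top : s ≤ top
  s≤top = ≤-trans (m≤n+m s s) (≤-trans (m≤n+m (s + s) (lo + G)) room)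
  c+s≡top : c + s ≡ top
  c+s≡top = m∸n+n≡m s≤top
  c≤top : c ≤ top
  c≤top = m∸n≤m top s
  gap : lo + s + G ≤ c
  gap = m+n≤o⇒m≤o∸n (lo + s + G) (subst (_≤ top) (shuffle lo s G) room)
    where
    shuffle : ∀ lo s g → lo + g + (s + s) ≡ lo + s + g + s
    shuffle = solve-∀
  lo+s<c : suc lo + s ≤ c
  lo+s<c = ≤-trans (m<m+n (lo + s) 1≤G) gap

module Endgame (k t : ℕ) where
  open Game (Target k t) public

  win-by-red-cycle : ∀ {B f L w} xs → suc (length xs) ≡ k → 3 ≤ k → InjectiveUpTo f L →
                     All (_≤ L) (w ∷ xs) → Unique (w ∷ xs) →
                     Walk (λ a b → RedOrForced B (f a) (f b)) w xs w → Win (Target k t) k B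
  win-by-red-cycle {B} xs length≡k 3≤k f-inj bounded unique walk =
    subst (λ m → Win (Target k t) m B) length≡k
      (Win-by-red-walk xs walk λ _ red-walk →
        inj₁ (subst (HasCycle _ red) length≡k
          (closed-walk⇒HasCycle xs f-inj bounded unique (≤-pred (subst (3 ≤_) (sym length≡k) 3≤k)) red-walk)))

  module Chords (G : ℕ) (2≤G : 2 ≤ G) (G-long : t ∸ k ≤ 2 * suc G) where

    Chord-forced : ∀ {B g lo hi u v} → BlueRun B g lo hi → InjectiveUpTo g hi → hi < t →
                   Chord G lo hi u v → RedOrForced B (g u) (g v)
    Chord-forced {B} {g} {lo} {hi} {u} {v} run g-inj hi<t (lo≤u , u+G≤v , v≤hi) = inj₂ (distinct , forced)
      where
      d : ℕ
      d = v ∸ u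
      u≤v : u ≤ v
      u≤v = ≤-trans (m≤m+n u G) u+G≤v
      u+d≡v : u + d ≡ v
      u+d≡v = m+[n∸m]≡n u≤v
      G≤d : G ≤ d
      G≤d = m+n≤o⇒m≤o∸n G (subst (_≤ v) (+-comm u G) u+G≤v)
      distinct : g u ≢ g v
      distinct eq with g-inj (≤-trans u≤v v≤hi) v≤hi eq
      ... | refl = <-irrefl refl (≤-trans (m<m+n u (≤-trans (s≤s z≤n) 2≤G)) u+G≤v)
      forced : ∀ {B'} → B ⊆ B' → Colored B' (g u) (g v) blue → Target k t B'
      forced {B'} B⊆B' uv = inj₂ (suc d , ≤-trans G-long (*-monoʳ-≤ 2 (s≤s G≤d)) ,
                              ≤-trans (s≤s (≤-trans (m∸n≤m v u) v≤hi)) hi<t ,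
                              blue-chord⇒HasCycle d (BlueRun-mono B⊆B' run) g-inj lo≤u
                                (subst (_≤ hi) (sym u+d≡v) v≤hi) (≤-trans 2≤G G≤d)
                                (subst (λ m → Colored B' (g u) (g m) blue) (sym u+d≡v) uv))

    LongChord-forced : ∀ {B g lo hi u v} → BlueRun B g lo hi → InjectiveUpTo g hi → hi < t →
                       LongChord G lo hi u v → RedOrForced B (g u) (g v)
    LongChord-forced run g-inj hi<t (inj₁ uv) = Chord-forced run g-inj hi<t uv
    LongChord-forced run g-inj hi<t (inj₂ vu) = RedOrForced-sym (Chord-forced run g-inj hi<t vu)

-- k = 2n + 3 and t = 2k + 2h + e. H has vertices 0, …, T1 = t - 1, the rerouted blue path has
-- vertices 0, …, T2, and chords spanning at least G path edges close cycles of 𝒞 (G-long).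
module Play (n h e : ℕ) (e≤1 : e ≤ 1) where

  k T2 T1 t G : ℕ
  k = 3 + (n + n)
  T2 = 4 + (n + n + n + n + h + h + e)
  T1 = suc T2
  t = suc T1
  G = 2 + (n + h)

  G-long : t ∸ k ≤ 2 * suc G
  G-long = subst (_≤ 2 * suc G) (sym t∸k≡)
             (≤-trans (+-monoʳ-≤ (3 + (n + n + h + h)) e≤1) (m+n≡o⇒m≤o 2 (bound n h)))
    where
    t≡ : ∀ n h e → 6 + (n + n + n + n + h + h + e) ≡ 3 + (n + n) + (3 + (n + n + h + h + e))
    t≡ = solve-∀
    t∸k≡ : t ∸ k ≡ 3 + (n + n + h + h + e)
    t∸k≡ = trans (cong (_∸ k) (t≡ n h e)) (m+n∸m≡n k _)
    bound : ∀ n h → 3 + (n + n + h + h) + 1 + 2 ≡ 2 * suc (2 + (n + h))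
    bound = solve-∀

  open Endgame k t
  open Chords G (s≤s (s≤s z≤n)) G-long

  3≤k : 3 ≤ k
  3≤k = s≤s (s≤s (s≤s z≤n))

  T2<t : T2 < t
  T2<t = n≤1+n T1

  n<G : n < G
  n<G = m+n≡o⇒m≤o (suc h) (+-suc (suc n) h)

  c₀ : ℕ
  c₀ = 4 + (n + n + n + h + h + e)

  c₀+n≡T2 : c₀ + n ≡ T2
  c₀+n≡T2 = identity n h e
    where
    identity : ∀ n h e → 4 + (n + n + n + h + h + e) + n ≡ 4 + (n + n + n + n + h + h + e)
    identity = solve-∀

  G+G≤c₀ : G + G ≤ c₀
  G+G≤c₀ = m+n≡o⇒m≤o (n + e) (identity n h e)
    where
    identity : ∀ n h e → 2 + (n + h) + (2 + (n + h)) + (n + e) ≡ 4 + (n + n + n + h + h + e)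
    identity = solve-∀

  G+G≤T2 : G + G ≤ T2
  G+G≤T2 = ≤-trans G+G≤c₀ (m+n≡o⇒m≤o n c₀+n≡T2)

  G≤T2 : G ≤ T2
  G≤T2 = ≤-trans (m≤m+n G G) G+G≤T2

  T1≡ : T1 ≡ n + n + (G + G) + suc e
  T1≡ = identity n h e
    where
    identity : ∀ n h e → 5 + (n + n + n + n + h + h + e) ≡ n + n + (2 + (n + h) + (2 + (n + h))) + suc e
    identity = solve-∀

  right-room⇒r<T2 : ∀ {r} → suc r + G ≤ T1 → r < T2
  right-room⇒r<T2 {r} room = ≤-pred (≤-trans (m<m+n (suc r) (s≤s z≤n)) room)

  -- The red cycle is G, 0, c₀, 1, c₀ + 1, …, n, c₀ + n = T2.
  blue-path-win : ∀ {B g} → BlueRun B g 0 T2 → InjectiveUpTo g T2 → Win (Target k t) k B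
  blue-path-win {B} {g} run g-inj =
    win-by-red-cycle xs length≡k 3≤k g-inj bounded unique
      (Walk-map (LongChord-forced run g-inj T2<t) xs walk)
    where
    xs : List ℕ
    xs = 0 ∷ zigzag c₀ 1 n ++ c₀ + n ∷ []
    xs≡ : xs ≡ zigzag 0 c₀ (suc n)
    xs≡ = zigzag-rotate c₀ 0 n
    G<c₀ : G < c₀
    G<c₀ = ≤-trans (m<m+n G (s≤s z≤n)) G+G≤c₀
    n+G≤c₀ : n + G ≤ c₀
    n+G≤c₀ = ≤-trans (+-monoˡ-≤ G (<⇒≤ n<G)) G+G≤c₀
    walk : Walk (LongChord G 0 T2) G xs G
    walk = Walk-++ (0 ∷ zigzag c₀ 1 n) []
             (inj₂ (z≤n , ≤-refl , G≤T2) , zigzag-chords-upward G n c₀ T2 n+G≤c₀ (≤-reflexive c₀+n≡T2))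
             (inj₂ (z≤n , ≤-trans G+G≤c₀ (m≤m+n c₀ n) , ≤-reflexive c₀+n≡T2))
    in-ranges : ∀ {P : ℕ → Set} → (∀ {v} → v ≤ n → P v) → (∀ {v} → c₀ ≤ v → v ≤ T2 → P v) →
                All P xs
    in-ranges low high = subst (All _) (sym xs≡) (zigzag-all 0 c₀ (suc n) λ {v} → λ
      { (inj₁ (_ , v<)) → low (≤-pred v<)
      ; (inj₂ (c₀≤ , v<)) → high c₀≤ (≤-pred (subst (v <_) (trans (+-suc c₀ n) (cong suc c₀+n≡T2)) v<)) })
    bounded : All (_≤ T2) (G ∷ xs)
    bounded = G≤T2 ∷ in-ranges (λ v≤n → ≤-trans v≤n (≤-trans (<⇒≤ n<G) G≤T2)) (λ _ v≤ → v≤)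
    unique : Unique (G ∷ xs)
    unique = in-ranges (λ v≤n → >⇒≢ (≤-trans (s≤s v≤n) n<G)) (λ c₀≤ _ → <⇒≢ (≤-trans G<c₀ c₀≤))
           ∷ subst Unique (sym xs≡) (zigzag-unique 0 c₀ (suc n) (inj₁ (≤-trans n<G (<⇒≤ G<c₀))))
    length≡k : suc (length xs) ≡ k
    length≡k = cong (suc ∘ suc) (trans (length-++ (zigzag c₀ 1 n))
                                       (trans (cong (_+ 1) (length-zigzag c₀ 1 n)) (+-comm (n + n) 1)))

  -- The red cycle is T1, (a zigzag above r + 1), r + 1, r, left, T1.
  red-cycle-win : ∀ {B f r} s → InjectiveUpTo f T1 → BlueRun B f (suc r) T1 →
                  Colored B (f r) (f (suc r)) red → suc r + G + (s + s) ≤ T1 →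
                  ∀ left → All (_< r) left → Unique left → Walk (λ a b → RedOrForced B (f a) (f b)) r left T1 →
                  s + s + length left ≡ n + n → Win (Target k t) k B
  red-cycle-win {B} {f} {r} s f-inj right red-edge room left left<r left-unique left-walk lengths =
    let (zs , |zs| , zs-range , zs-unique , chords) = zigzag-above G (suc r) s T1 (s≤s z≤n) room
        below-T1 : All (_< T1) (zs ++ suc r ∷ r ∷ left)
        below-T1 = All-++⁺ (All.map proj₂ zs-range) (All.map (λ v<2+r → ≤-trans v<2+r 1+r<T1) rest-below)
    in win-by-red-cycle (zs ++ suc r ∷ r ∷ left) (length≡k zs |zs|) 3≤k f-inj (≤-refl ∷ All.map <⇒≤ below-T1)
         (All.map >⇒≢ below-T1 ∷
          Unique-++⁺ zs-unique (All.map >⇒≢ below-1+r ∷ All.map >⇒≢ left<r ∷ left-unique)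
            λ { (v∈zs , v∈rest) →
                <-irrefl refl (≤-trans (All.lookup rest-below v∈rest) (proj₁ (All.lookup zs-range v∈zs))) })
         (Walk-++ zs (r ∷ left) (Walk-map (LongChord-forced right f-inj ≤-refl) zs chords)
                                (inj₁ (Colored-sym red-edge) , left-walk))
    where
    1+r<T1 : suc r < T1
    1+r<T1 = ≤-trans (m<m+n (suc r) (s≤s z≤n)) (≤-trans (m≤m+n (suc r + G) (s + s)) room)
    below-1+r : All (_< suc r) (r ∷ left)
    below-1+r = n<1+n r ∷ All.map (λ v<r → <-trans v<r (n<1+n r)) left<r
    rest-below : All (_< suc (suc r)) (suc r ∷ r ∷ left)
    rest-below = n<1+n (suc r) ∷ All.map (λ v<1+r → <-trans v<1+r (n<1+n (suc r))) below-1+r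
    length≡k : ∀ zs → length zs ≡ s + s → suc (length (zs ++ suc r ∷ r ∷ left)) ≡ k
    length≡k zs |zs| = begin
      suc (length (zs ++ suc r ∷ r ∷ left)) ≡⟨ cong suc (trans (length-++ zs) (cong (_+ (2 + length left)) |zs|)) ⟩
      suc (s + s + (2 + length left))       ≡⟨ shuffle s (length left) ⟩
      3 + (s + s + length left)             ≡⟨ cong (3 +_) lengths ⟩
      k                                     ∎
      where
      open ≡-Reasoning
      shuffle : ∀ s l → suc (s + s + (2 + l)) ≡ 3 + (s + s + l)
      shuffle = solve-∀

  first-move : ∀ {B f r} x → x ≤ r → r ≤ suc x → r < T2 → InjectiveUpTo f T1 →
               BlueRun B f 0 r → BlueRun B f (suc r) T1 →
               (∀ {B₁} → B ⊆ B₁ → Colored B₁ (f x) (f T1) red → Win (Target k t) k B₁) →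
               Win (Target k t) (suc k) B
  first-move {f = f} x x≤r r≤1+x r<T2 f-inj left right if-red = Win-by-edge k distinct λ
    { red  B⊆B₁ xT1 → if-red B⊆B₁ xT1
    ; blue B⊆B₁ xT1 → let (g , run , g-inj) = reroute f-inj (BlueRun-mono B⊆B₁ left) (BlueRun-mono B⊆B₁ right)
                                                        x≤r r≤1+x r<T2 xT1
                      in blue-path-win run g-inj }
    where
    x<T1 : x < T1
    x<T1 = ≤-trans (s≤s x≤r) (≤-trans r<T2 (n≤1+n T2))
    distinct : f x ≢ f T1
    distinct eq = <-irrefl (f-inj (<⇒≤ x<T1) ≤-refl eq) x<T1

  long-right-win : ∀ {B f r} → InjectiveUpTo f T1 → BlueRun B f 0 r → Colored B (f r) (f (suc r)) red →
                   BlueRun B f (suc r) T1 → suc r + G + (n + n) ≤ T1 → Win (Target k t) (suc k) B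
  long-right-win {r = r} f-inj left red-edge right room =
    first-move r ≤-refl (n≤1+n r) (right-room⇒r<T2 (≤-trans (m≤m+n (suc r + G) (n + n)) room)) f-inj left right
      λ B⊆B₁ rT1 → red-cycle-win n f-inj (BlueRun-mono B⊆B₁ right) (Colored-mono B⊆B₁ red-edge) room
                     [] [] [] (inj₁ rT1) (+-identityʳ (n + n))

  left-room : ∀ {r} j → j < n → T1 ≤ suc r + G + suc (j + j) → let m = n ∸ suc j in suc (m + G + m) ≤ r
  left-room {r} j j<n tight = +-cancelʳ-≤ (suc G + suc (j + j)) (suc (m + G + m)) r (begin
      suc (m + G + m) + (suc G + suc (j + j)) ≡⟨ both-sides ⟩
      n + n + (G + G) + 1                      ≤⟨ +-monoʳ-≤ (n + n + (G + G)) (s≤s z≤n) ⟩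
      n + n + (G + G) + suc e                  ≡⟨ sym T1≡ ⟩
      T1                                       ≤⟨ tight ⟩
      suc r + G + suc (j + j)                  ≡⟨ trans (+-assoc (suc r) G _) (sym (+-suc r _)) ⟩
      r + (suc G + suc (j + j))                ∎)
    where
    open ≤-Reasoning
    m : ℕ
    m = n ∸ suc j
    identity : ∀ m j g → suc (m + g + m) + (suc g + suc (j + j)) ≡ suc j + m + (suc j + m) + (g + g) + 1
    identity = solve-∀
    both-sides : suc (m + G + m) + (suc G + suc (j + j)) ≡ n + n + (G + G) + 1
    both-sides = subst (λ N → suc (m + G + m) + (suc G + suc (j + j)) ≡ N + N + (G + G) + 1)
                       (m+[n∸m]≡n j<n) (identity m j G)

  short-right-win : ∀ {B f r} j → j < n → InjectiveUpTo f T1 → BlueRun B f 0 r →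
                    Colored B (f r) (f (suc r)) red → BlueRun B f (suc r) T1 →
                    suc r + G + (j + j) ≤ T1 → T1 ≤ suc r + G + suc (j + j) → Win (Target k t) (suc k) B
  short-right-win {B} {f} {r} j j<n f-inj left red-edge right room tight =
    let (zs , |zs| , below-x , unique , chords) = zigzag-below G m x (s≤s z≤n) wide-left in
    first-move x x≤r r≤1+x r<T2 f-inj left right λ B⊆B₁ xT1 →
      red-cycle-win j f-inj (BlueRun-mono B⊆B₁ right) (Colored-mono B⊆B₁ red-edge) room
        (zs ++ x ∷ []) (All.map (λ v≤x → ≤-trans (s≤s v≤x) 1+x≤r) below-x) unique
        (left-walk zs B⊆B₁ chords xT1) (lengths zs |zs|)
    where
    m : ℕ
    m = n ∸ suc j
    n≡ : suc j + m ≡ n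
    n≡ = m+[n∸m]≡n j<n
    r<T2 : r < T2
    r<T2 = right-room⇒r<T2 (≤-trans (m≤m+n (suc r + G) (j + j)) room)
    r≤T1 : r ≤ T1
    r≤T1 = ≤-trans (<⇒≤ r<T2) (n≤1+n T2)
    x : ℕ
    x = r ∸ 1
    r≡1+x : r ≡ suc x
    r≡1+x = sym (m+[n∸m]≡n (≤-trans (s≤s z≤n) (left-room j j<n tight)))
    1+x≤r : suc x ≤ r
    1+x≤r = ≤-reflexive (sym r≡1+x)
    r≤1+x : r ≤ suc x
    r≤1+x = ≤-reflexive r≡1+x
    x≤r : x ≤ r
    x≤r = m∸n≤m r 1
    wide-left : m + G + m ≤ x
    wide-left = ≤-pred (≤-trans (left-room j j<n tight) r≤1+x)
    left-walk : ∀ {B₁} zs → B ⊆ B₁ → Walk (LongChord G 0 (suc x)) (suc x) zs x → Colored B₁ (f x) (f T1) red →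
                Walk (λ a b → RedOrForced B₁ (f a) (f b)) r (zs ++ x ∷ []) T1
    left-walk zs B⊆B₁ chords xT1 =
      Walk-++ zs [] (Walk-map (LongChord-forced (BlueRun-mono B⊆B₁ left) (InjectiveUpTo-sub r≤T1 f-inj) (s≤s r≤T1)) zs
                              (subst (λ y → Walk (LongChord G 0 y) y zs x) (sym r≡1+x) chords))
                    (inj₁ xT1)
    lengths : ∀ zs → length zs ≡ suc (m + m) → j + j + length (zs ++ x ∷ []) ≡ n + n
    lengths zs |zs| = begin
      j + j + length (zs ++ x ∷ []) ≡⟨ cong (j + j +_) (trans (length-++ zs) (cong (_+ 1) |zs|)) ⟩
      j + j + (suc (m + m) + 1)     ≡⟨ identity j m ⟩
      suc j + m + (suc j + m)       ≡⟨ cong (λ N → N + N) n≡ ⟩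
      n + n                         ∎
      where
      open ≡-Reasoning
      identity : ∀ j m → j + j + (suc (m + m) + 1) ≡ suc j + m + (suc j + m)
      identity = solve-∀

  -- j zigzag pairs fit to the right of the red edge; if j < n, the other n - j - 1 pairs go to its left.
  red-case : ∀ {B f r} → InjectiveUpTo f T1 → BlueRun B f 0 r → Colored B (f r) (f (suc r)) red →
             BlueRun B f (suc r) T1 → suc r + G ≤ T1 → Win (Target k t) (suc k) B
  red-case {B} {f} {r} f-inj left red-edge right right-room = by-length (n ≤? j)
    where
    c j : ℕ
    c = T1 ∸ (suc r + G)
    j = c / 2
    r+G+c≡T1 : suc r + G + c ≡ T1
    r+G+c≡T1 = m+[n∸m]≡n right-room
    room : suc r + G + (j + j) ≤ T1
    room = subst (suc r + G + (j + j) ≤_) r+G+c≡T1 (+-monoʳ-≤ (suc r + G) (proj₁ (half-bounds c)))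
    tight : T1 ≤ suc r + G + suc (j + j)
    tight = subst (_≤ suc r + G + suc (j + j)) r+G+c≡T1 (+-monoʳ-≤ (suc r + G) (proj₂ (half-bounds c)))
    by-length : Dec (n ≤ j) → Win (Target k t) (suc k) B
    by-length (yes n≤j) =
      long-right-win f-inj left red-edge right (≤-trans (+-monoʳ-≤ (suc r + G) (+-mono-≤ n≤j n≤j)) room)
    by-length (no n≰j)  = short-right-win j (≰⇒> n≰j) f-inj left red-edge right room tight

  almost-blue-path-win : ∀ {B f} → AlmostBluePath B f T1 → Win (Target k t) (suc k) B
  almost-blue-path-win (f-inj , inj₁ run) =
    Win-suc k (blue-path-win (BlueRun-sub ≤-refl (n≤1+n T2) run) (InjectiveUpTo-sub (n≤1+n T2) f-inj))
  almost-blue-path-win {f = f} (f-inj , inj₂ (r , r<T1 , left , red-edge , right)) with suc r + G ≤? T1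
  ... | yes right-room = red-case f-inj left red-edge right right-room
  ... | no  right-short =
    let (left' , red-edge' , right') = red-edge-mirror r<T1 left red-edge right
    in red-case (InjectiveUpTo-mirror T1 f-inj) left' red-edge' right' mirrored-room
    where
    r≤T2 : r ≤ T2
    r≤T2 = ≤-pred r<T1
    G≤r : G ≤ r
    G≤r = +-cancelʳ-≤ G G r (≤-trans G+G≤T2 (≤-trans (n≤1+n T2) (≤-pred (≰⇒> right-short))))
    mirrored-room : suc (T2 ∸ r) + G ≤ T1
    mirrored-room = s≤s (≤-trans (+-monoʳ-≤ (T2 ∸ r) G≤r) (≤-reflexive (m∸n+n≡m r≤T2)))

-- Past the end of the list these return the junk values 0 and blue; they are only used at valid indices.
vertexAt : List ℕ → ℕ → ℕ
vertexAt []       _       = 0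
vertexAt (v ∷ vs) zero    = v
vertexAt (v ∷ vs) (suc i) = vertexAt vs i

colourAt : List Color → ℕ → Color
colourAt []       _       = blue
colourAt (c ∷ cs) zero    = c
colourAt (c ∷ cs) (suc i) = colourAt cs i

vertexAt-∈ : ∀ vs {i} → i < length vs → vertexAt vs i ∈ vs
vertexAt-∈ (v ∷ vs) {zero}  _        = here refl
vertexAt-∈ (v ∷ vs) {suc i} (s≤s i<) = there (vertexAt-∈ vs i<)

vertexAt-injective : ∀ {vs} → Unique vs → ∀ {i j} → i < length vs → j < length vs →
                     vertexAt vs i ≡ vertexAt vs j → i ≡ j
vertexAt-injective {v ∷ vs} (v∉ ∷ _) {zero}  {zero}  _        _        _  = refl
vertexAt-injective {v ∷ vs} (v∉ ∷ _) {zero}  {suc j} _        (s≤s j<) eq =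
  ⊥-elim (All.lookup v∉ (vertexAt-∈ vs j<) eq)
vertexAt-injective {v ∷ vs} (v∉ ∷ _) {suc i} {zero}  (s≤s i<) _        eq =
  ⊥-elim (All.lookup v∉ (vertexAt-∈ vs i<) (sym eq))
vertexAt-injective {v ∷ vs} (_ ∷ u)  {suc i} {suc j} (s≤s i<) (s≤s j<) eq =
  cong suc (vertexAt-injective u i< j< eq)

pathBoard-edge : ∀ vs cs {i} → suc i < length vs → i < length cs →
                 (vertexAt vs i , vertexAt vs (suc i) , colourAt cs i) ∈ pathBoard vs cs
pathBoard-edge (u ∷ v ∷ vs) (c ∷ cs) {zero}  _        _        = here refl
pathBoard-edge (u ∷ [])     cs       {zero}  (s≤s ()) _
pathBoard-edge (u ∷ v ∷ vs) (c ∷ cs) {suc i} (s≤s i<) (s≤s j<) = there (pathBoard-edge (v ∷ vs) cs i< j<)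

no-red⇒blue : ∀ cs → countRed cs ≤ 0 → ∀ i → colourAt cs i ≡ blue
no-red⇒blue []          _ _       = refl
no-red⇒blue (blue ∷ cs) p zero    = refl
no-red⇒blue (blue ∷ cs) p (suc i) = no-red⇒blue cs p i

OnlyRedAt : List Color → ℕ → Set
OnlyRedAt cs r = r < length cs × colourAt cs r ≡ red × (∀ i → i ≢ r → colourAt cs i ≡ blue)

almost-blue-colours : ∀ cs → AlmostBlue cs → (∀ i → colourAt cs i ≡ blue) ⊎ ∃[ r ] OnlyRedAt cs r
almost-blue-colours []          _       = inj₁ λ _ → refl
almost-blue-colours (red ∷ cs)  (s≤s p) =
  inj₂ (0 , s≤s z≤n , refl , λ { zero 0≢0 → ⊥-elim (0≢0 refl) ; (suc i) _ → no-red⇒blue cs p i })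
almost-blue-colours (blue ∷ cs) p with almost-blue-colours cs p
... | inj₁ all-blue = inj₁ λ { zero → refl ; (suc i) → all-blue i }
... | inj₂ (r , r< , red-at-r , blue-elsewhere) =
  inj₂ (suc r , s≤s r< , red-at-r , λ { zero _ → refl ; (suc i) i≢r → blue-elsewhere i (i≢r ∘ cong suc) })

pathBoard-AlmostBluePath : ∀ {vs cs L} → Unique vs → length vs ≡ suc L → length cs ≡ L → AlmostBlue cs →
                           AlmostBluePath (pathBoard vs cs) (vertexAt vs) L
pathBoard-AlmostBluePath {vs} {cs} {L} unique |vs| |cs| almost-blue =
  (λ i≤L j≤L → vertexAt-injective unique (on-path i≤L) (on-path j≤L)) ,
  Sum.map all-blue-run one-red-run (almost-blue-colours cs almost-blue)
  where
  B : Board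
  B = pathBoard vs cs
  on-path : ∀ {i} → i ≤ L → i < length vs
  on-path i≤L = subst (_ <_) (sym |vs|) (s≤s i≤L)
  edge : ∀ {i} → i < L → Colored B (vertexAt vs i) (vertexAt vs (suc i)) (colourAt cs i)
  edge i<L = inj₁ (pathBoard-edge vs cs (on-path i<L) (subst (_ <_) (sym |cs|) i<L))
  blue-edge : ∀ {i} → i < L → colourAt cs i ≡ blue → Colored B (vertexAt vs i) (vertexAt vs (suc i)) blue
  blue-edge i<L is-blue = subst (Colored B _ _) is-blue (edge i<L)
  all-blue-run : (∀ i → colourAt cs i ≡ blue) → BlueRun B (vertexAt vs) 0 L
  all-blue-run all-blue {i} _ i<L = blue-edge i<L (all-blue i)
  one-red-run : ∃[ r ] OnlyRedAt cs r → ∃[ r ] RedEdgeAt B (vertexAt vs) L r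
  one-red-run (r , r< , red-at-r , blue-elsewhere) =
    r , r<L ,
    (λ {i} _ i<r → blue-edge (<-trans i<r r<L) (blue-elsewhere i (<⇒≢ i<r))) ,
    subst (Colored B _ _) red-at-r (edge r<L) ,
    (λ {i} r<i i<L → blue-edge i<L (blue-elsewhere i (>⇒≢ r<i)))
    where
    r<L : r < L
    r<L = subst (r <_) |cs| r<

lemma16 : (k t : ℕ) → 3 ≤ k → Odd k → 2 * k ≤ t →
            (vs : List ℕ) (cs : List Color) →
            Unique vs → length vs ≡ t → length cs ≡ t ∸ 1 → AlmostBlue cs →
            Win (Target k t) (k + 1) (pathBoard vs cs)
lemma16 k t 3≤k (zero , k≡1) _ _ _ _ _ _ _ with ≤-trans 3≤k (≤-reflexive k≡1)
... | s≤s ()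
lemma16 k t 3≤k (suc n , k≡) 2k≤t vs cs unique |vs| |cs| almost-blue =
  subst₂ (λ K T → Win (Target K T) (K + 1) (pathBoard vs cs)) (sym k≡K) (sym t≡T)
    (subst (λ m → Win (Target K T) m (pathBoard vs cs)) (+-comm 1 K)
      (Play.almost-blue-path-win n h e e≤1
        (pathBoard-AlmostBluePath unique (trans |vs| t≡T) (trans |cs| (cong (_∸ 1) t≡T)) almost-blue)))
  where
  h e : ℕ
  h = (t ∸ 2 * k) / 2
  e = (t ∸ 2 * k) % 2
  e≤1 : e ≤ 1
  e≤1 = ≤-pred (m%n<n (t ∸ 2 * k) 2)
  K T : ℕ
  K = Play.k n h e e≤1
  T = Play.t n h e e≤1
  k≡K : k ≡ K
  k≡K = trans k≡ (identity n)
    where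
    identity : ∀ n → suc (2 * suc n) ≡ 3 + (n + n)
    identity = solve-∀
  t≡T : t ≡ T
  t≡T = begin
    t                                ≡⟨ sym (m+[n∸m]≡n 2k≤t) ⟩
    2 * k + (t ∸ 2 * k)              ≡⟨ cong₂ (λ a b → 2 * a + b) k≡K (m≡m%n+[m/n]*n (t ∸ 2 * k) 2) ⟩
    2 * K + (e + h * 2)              ≡⟨ identity n h e ⟩
    T                                ∎
    where
    open ≡-Reasoning
    identity : ∀ n h e → 2 * (3 + (n + n)) + (e + h * 2) ≡ 6 + (n + n + n + n + h + h + e)
    identity = solve-∀
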